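{- Let $(X,p)$ be a context-free grammar in Greibach normal form over a finite alphabet $A$, and let $S\in\mathcal{P}_\omega(X^*)$. Then, with respect to the grammar automaton generated from $(X,p)$, $[\![S]\!]=\bigcup_{s\in S}\{w\in A^*\mid s\Rightarrow^* w\}$.
   Context: A context-free grammar $(X,p)$ consists of a finite set $X$ of nonterminals (disjoint from $A$) and $p:X\to\mathcal{P}_\omega((A+X)^*)$; write $x\to u$ for $u\in p(x)$. One-step derivation: $v\Rightarrow w$ if $v=v_1xv_2$, $w=v_1uv_2$ with $x\to u$; $\Rightarrow^*$ is its reflexive transitive closure. Greibach normal form: every production is $x\to aw$ with $a\in A$, $w\in X^*$, or $x\to\epsilon$. The grammar coalgebra is $o(x)=1$ iff $x\to\epsilon$, $x_a=\{w\in X^*\mid x\to aw\}$. With $i(1)=\{\epsilon\}$, $i(0)=\emptyset$, the grammar automaton is the $\mathbb{B}\times(-)^A$-coalgebra $(\hat o,\hat\delta)$ on $\mathcal{P}_\omega(X^*)$ (write $S_a:=\hat\delta(S)(a)$): $\hat o(\{\epsilon\})=1$, $\{\epsilon\}_a=\emptyset$; for $x\in X$, $w\in X^*$: $\hat o(\{xw\})=o(x)\wedge\hat o(\{w\})$, $\{xw\}_a=x_a\{w\}\cup i(o(x))\{w\}_a$; for finite $S$: $\hat o(S)=\bigvee_{s\in S}\hat o(\{s\})$, $S_a=\bigcup_{s\in S}\{s\}_a$. $[\![-]\!]:\mathcal{P}_\omega(X^*)\to\mathcal{P}(A^*)$ is the unique homomorphism into the final $\mathbb{B}\times(-)^A$-coalgebra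 of languages ($o(L)=1$ iff $\epsilon\in L$, $L_a=\{w\mid aw\in L\}$), i.e. $[\![S]\!]=\{w\mid\hat o(S_w)=1\}$ with $S_\epsilon=S$, $S_{aw}=(S_a)_w$. -}

module Defs where

open import Data.Nat using (ℕ)
open import Data.Fin using (Fin)
open import Data.Fin.Properties using (_≟_)
open import Data.Bool using (Bool; true; false; _∧_; _∨_; if_then_else_)
open import Data.List using (List; []; _∷_; _++_; map; concatMap; foldr)
open import Data.Bool.ListAction using (any)
open import Data.List.Membership.Propositional using (_∈_)
open import Data.Maybe using (Maybe; just; nothing)
open import Data.Sum using (_⊎_; inj₁; inj₂)
open import Data.Product using (Σ; ∃; ∃-syntax; _×_; _,_)
open import Relation.Binary.PropositionalEquality using (_≡_)
open import Relation.Binary.Construct.Closure.ReflexiveTransitive using (Star)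
open import Relation.Nullary using (yes; no)

-- A context-free grammar over the finite alphabet A = Fin nA with the finite
-- set of nonterminals X = Fin nX (disjointness: words are over A ⊎ X).
-- p(x) ∈ P_ω((A+X)*) is represented by a finite list of words.
record Grammar (nA nX : ℕ) : Set where
  field
    prods : Fin nX → List (List (Fin nA ⊎ Fin nX))

module _ {nA nX : ℕ} where

  A X : Set
  A = Fin nA
  X = Fin nX

  _⊢_→ₚ_ : Grammar nA nX → X → List (A ⊎ X) → Set
  G ⊢ x →ₚ u = u ∈ Grammar.prods G x

  GreibachNF : Grammar nA nX → Set
  GreibachNF G = ∀ (x : X) (u : List (A ⊎ X)) → G ⊢ x →ₚ u →
                   (u ≡ []) ⊎ (∃[ a ] ∃[ w ] (u ≡ inj₁ a ∷ map inj₂ w))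

  data _⊢_⇒_ (G : Grammar nA nX) : List (A ⊎ X) → List (A ⊎ X) → Set where
    step : ∀ (v₁ v₂ : List (A ⊎ X)) (x : X) (u : List (A ⊎ X)) →
           G ⊢ x →ₚ u → G ⊢ (v₁ ++ inj₂ x ∷ v₂) ⇒ (v₁ ++ u ++ v₂)

  _⊢_⇒*_ : Grammar nA nX → List (A ⊎ X) → List (A ⊎ X) → Set
  G ⊢ v ⇒* w = Star (G ⊢_⇒_) v w

  isEmptyWord : List (A ⊎ X) → Bool
  isEmptyWord [] = true
  isEmptyWord (_ ∷ _) = false

  oG : Grammar nA nX → X → Bool
  oG G x = any isEmptyWord (Grammar.prods G x)

  allNT : List (A ⊎ X) → Maybe (List X)
  allNT [] = just []
  allNT (inj₁ _ ∷ _) = nothing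
  allNT (inj₂ y ∷ u) with allNT u
  ... | just w = just (y ∷ w)
  ... | nothing = nothing

  stripA : A → List (A ⊎ X) → List (List X)
  stripA a (inj₁ b ∷ u) with b ≟ a | allNT u
  ... | yes _ | just w = w ∷ []
  ... | _ | _ = []
  stripA a _ = []

  δG : Grammar nA nX → X → A → List (List X)
  δG G x a = concatMap (stripA a) (Grammar.prods G x)

  i : Bool → List (List X)
  i true = [] ∷ []
  i false = []

  _·_ : List (List X) → List X → List (List X)
  T · w = map (_++ w) T

  ô₁ : Grammar nA nX → List X → Bool
  ô₁ G [] = true
  ô₁ G (x ∷ w) = oG G x ∧ ô₁ G w

  δ̂₁ : Grammar nA nX → List X → A → List (List X)
  δ̂₁ G [] a = []
  δ̂₁ G (x ∷ w) a = (δG G x a · w) ++ (if oG G x then δ̂₁ G w a else [])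

  ô : Grammar nA nX → List (List X) → Bool
  ô G S = foldr (λ s b → ô₁ G s ∨ b) false S

  δ̂ : Grammar nA nX → List (List X) → A → List (List X)
  δ̂ G S a = concatMap (λ s → δ̂₁ G s a) S

  δ̂* : Grammar nA nX → List (List X) → List A → List (List X)
  δ̂* G S [] = S
  δ̂* G S (a ∷ w) = δ̂* G (δ̂ G S a) w

  ⟦_⟧ : Grammar nA nX → List (List X) → List A → Set
  ⟦ G ⟧ S w = ô G (δ̂* G S w) ≡ true

-- Since S_a is the union of the {s}_a, acceptance from S reduces to runs from
-- single words s. The a-successors of {s} are the words s' reached from s by
-- erasing nullable leading nonterminals and then applying one production
-- x → a v, so an accepting run spells out a leftmost derivation of w.
-- Conversely, a derivation s ⇒* w yields a parse forest; in Greibach normal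
-- form the tree of the first nonterminal of s either derives ε or begins with
-- the first letter of w, and regrouping its subtrees gives a parse forest of
-- an a-successor, so induction on w produces a run.
module Submission where

open import Defs
open import Data.Nat using (ℕ; suc; _≤_; s≤s)
open import Data.Nat.Properties using (≤-refl)
open import Data.Fin using (Fin)
open import Data.Fin.Properties using (_≟_)
open import Data.Bool using (true; false; if_then_else_)
open import Data.List using (List; []; _∷_; _++_; map; length)
open import Data.List.Properties using (map-++; ++-assoc)
open import Data.List.Relation.Unary.Any using (here; there)
open import Data.List.Membership.Propositional using (_∈_; find; lose)
open import Data.List.Membership.Propositional.Properties
  using (∈-++⁺ˡ; ∈-++⁺ʳ; ∈-++⁻; ∈-map⁺; ∈-map⁻; ∈-concatMap⁺; ∈-concatMap⁻)
open import Data.Bool.ListAction using (any)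
open import Data.Maybe using (just)
open import Data.Sum using (_⊎_; inj₁; inj₂)
open import Data.Product using (∃-syntax; _×_; _,_)
open import Function.Bundles using (_⇔_; mk⇔; Equivalence)
open import Relation.Binary.PropositionalEquality using (_≡_; refl; sym; cong; subst)
open import Relation.Binary.Construct.Closure.ReflexiveTransitive using (ε; _◅_; _◅◅_; gmap)
open import Relation.Nullary using (yes; no)

module _ {nA nX : ℕ} where

  private
    Letter = Fin nA
    Nonterminal = Fin nX
    Symbol = Letter ⊎ Nonterminal

  allNT-just : ∀ (u : List Symbol) {v} → allNT u ≡ just v → u ≡ map inj₂ v
  allNT-just [] refl = refl
  allNT-just (inj₂ y ∷ u) e with allNT u in eq
  allNT-just (inj₂ y ∷ u) refl | just v = cong (inj₂ y ∷_) (allNT-just u eq)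

  allNT-map-inj₂ : ∀ (v : List Nonterminal) → allNT {nA} (map inj₂ v) ≡ just v
  allNT-map-inj₂ [] = refl
  allNT-map-inj₂ (y ∷ v) rewrite allNT-map-inj₂ v = refl

  ∈-stripA⁻ : ∀ (a : Letter) (u : List Symbol) {v} →
              v ∈ stripA a u → u ≡ inj₁ a ∷ map inj₂ v
  ∈-stripA⁻ a (inj₁ b ∷ u) v∈ with b ≟ a | allNT u in eq
  ∈-stripA⁻ a (inj₁ a ∷ u) (here refl) | yes refl | just v =
    cong (inj₁ a ∷_) (allNT-just u eq)

  ∈-stripA⁺ : ∀ (a : Letter) (v : List Nonterminal) → v ∈ stripA a (inj₁ a ∷ map inj₂ v)
  ∈-stripA⁺ a v with a ≟ a
  ... | yes _ rewrite allNT-map-inj₂ v = here refl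
  ... | no a≢a with () ← a≢a refl

  any-isEmptyWord⇔[]∈ : (us : List (List Symbol)) → any isEmptyWord us ≡ true ⇔ [] ∈ us
  any-isEmptyWord⇔[]∈ us = mk⇔ (to us) (from us)
    where
    to : ∀ us → any isEmptyWord us ≡ true → [] ∈ us
    to ([] ∷ us) _ = here refl
    to ((_ ∷ _) ∷ us) e = there (to us e)
    from : ∀ us → [] ∈ us → any isEmptyWord us ≡ true
    from ([] ∷ us) _ = refl
    from ((_ ∷ _) ∷ us) (there p) = from us p

  module _ (G : Grammar nA nX) where

    oG⇔→ₚε : ∀ x → oG G x ≡ true ⇔ G ⊢ x →ₚ []
    oG⇔→ₚε x = any-isEmptyWord⇔[]∈ (Grammar.prods G x)

    ∈-δG⁻ : ∀ x a {v} → v ∈ δG G x a → G ⊢ x →ₚ (inj₁ a ∷ map inj₂ v)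
    ∈-δG⁻ x a v∈ with find (∈-concatMap⁻ (stripA a) v∈)
    ... | u , u∈ , v∈u with ∈-stripA⁻ a u v∈u
    ... | refl = u∈

    ∈-δG⁺ : ∀ x a {v} → G ⊢ x →ₚ (inj₁ a ∷ map inj₂ v) → v ∈ δG G x a
    ∈-δG⁺ x a {v} x→av = ∈-concatMap⁺ (stripA a) (lose x→av (∈-stripA⁺ a v))

    ô⁻ : ∀ S → ô G S ≡ true → ∃[ s ] (s ∈ S × ô₁ G s ≡ true)
    ô⁻ (s ∷ S) e with ô₁ G s in eq
    ... | true = s , here refl , eq
    ... | false with ô⁻ S e
    ...   | t , t∈ , ot = t , there t∈ , ot

    ô⁺ : ∀ S {s} → s ∈ S → ô₁ G s ≡ true → ô G S ≡ true
    ô⁺ (s ∷ S) (here refl) e rewrite e = refl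
    ô⁺ (s ∷ S) (there s∈) e with ô₁ G s
    ... | true = refl
    ... | false = ô⁺ S s∈ e

    Run : List Nonterminal → List Letter → Set
    Run s [] = ô₁ G s ≡ true
    Run s (a ∷ w) = ∃[ s' ] (s' ∈ δ̂₁ G s a × Run s' w)

    ⟦⟧⇔Run : ∀ S w → ⟦ G ⟧ S w ⇔ (∃[ s ] (s ∈ S × Run s w))
    ⟦⟧⇔Run S w = mk⇔ (to S w) (from S w)
      where
      to : ∀ S w → ⟦ G ⟧ S w → ∃[ s ] (s ∈ S × Run s w)
      to S [] e = ô⁻ S e
      to S (a ∷ w) e with to (δ̂ G S a) w e
      ... | s' , s'∈ , run with find (∈-concatMap⁻ (λ s → δ̂₁ G s a) s'∈)
      ...   | s , s∈ , s'∈s = s , s∈ , s' , s'∈s , run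
      from : ∀ S w → ∃[ s ] (s ∈ S × Run s w) → ⟦ G ⟧ S w
      from S [] (s , s∈ , os) = ô⁺ S s∈ os
      from S (a ∷ w) (s , s∈ , s' , s'∈s , run) =
        from (δ̂ G S a) w (s' , ∈-concatMap⁺ (λ s → δ̂₁ G s a) (lose s∈ s'∈s) , run)

    ⇒-++ˡ : ∀ p {α β} → G ⊢ α ⇒ β → G ⊢ (p ++ α) ⇒ (p ++ β)
    ⇒-++ˡ p (step v₁ v₂ x u x→u) =
      subst (λ γ → G ⊢ γ ⇒ (p ++ v₁ ++ u ++ v₂)) (++-assoc p v₁ (inj₂ x ∷ v₂))
        (subst (G ⊢ ((p ++ v₁) ++ inj₂ x ∷ v₂) ⇒_) (++-assoc p v₁ (u ++ v₂))
          (step (p ++ v₁) v₂ x u x→u))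

    ⇒*-++ˡ : ∀ p {α β} → G ⊢ α ⇒* β → G ⊢ (p ++ α) ⇒* (p ++ β)
    ⇒*-++ˡ p = gmap (p ++_) (⇒-++ˡ p)

    expandHead : ∀ {x u v} → G ⊢ x →ₚ u → G ⊢ (inj₂ x ∷ v) ⇒ (u ++ v)
    expandHead {x} {u} {v} = step [] v x u

    ô₁⇒⇒*ε : ∀ s → ô₁ G s ≡ true → G ⊢ map inj₂ s ⇒* []
    ô₁⇒⇒*ε [] _ = ε
    ô₁⇒⇒*ε (x ∷ s) e with oG G x in ox
    ... | true = expandHead (Equivalence.to (oG⇔→ₚε x) ox) ◅ ô₁⇒⇒*ε s e

    ∈-δ̂₁⇒⇒* : ∀ s a {s'} → s' ∈ δ̂₁ G s a → G ⊢ map inj₂ s ⇒* (inj₁ a ∷ map inj₂ s')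
    ∈-δ̂₁⇒⇒* (x ∷ t) a s'∈ with ∈-++⁻ (_·_ {nA} (δG G x a) t) s'∈
    ... | inj₁ s'∈xa·t with ∈-map⁻ (_++ t) s'∈xa·t
    ...   | v , v∈xa , refl =
      subst (λ γ → G ⊢ map inj₂ (x ∷ t) ⇒* (inj₁ a ∷ γ)) (sym (map-++ inj₂ v t))
        (expandHead (∈-δG⁻ x a v∈xa) ◅ ε)
    ∈-δ̂₁⇒⇒* (x ∷ t) a s'∈ | inj₂ s'∈t with oG G x in ox
    ...   | true = expandHead (Equivalence.to (oG⇔→ₚε x) ox) ◅ ∈-δ̂₁⇒⇒* t a s'∈t

    Run⇒⇒* : ∀ s w → Run s w → G ⊢ map inj₂ s ⇒* map inj₁ w
    Run⇒⇒* s [] os = ô₁⇒⇒*ε s os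
    Run⇒⇒* s (a ∷ w) (s' , s'∈ , run) =
      ∈-δ̂₁⇒⇒* s a s'∈ ◅◅ ⇒*-++ˡ (inj₁ a ∷ []) (Run⇒⇒* s' w run)

    -- Parse α w: a forest of parse trees, one per symbol of α, with yield w.
    data Parse : List Symbol → List Letter → Set where
      []       : Parse [] []
      terminal : ∀ {a α w} → Parse α w → Parse (inj₁ a ∷ α) (a ∷ w)
      expand   : ∀ {x u α w₁ w₂} → G ⊢ x →ₚ u → Parse u w₁ → Parse α w₂ →
                 Parse (inj₂ x ∷ α) (w₁ ++ w₂)

    Parse-++ : ∀ {α β w₁ w₂} → Parse α w₁ → Parse β w₂ → Parse (α ++ β) (w₁ ++ w₂)
    Parse-++ [] pβ = pβ
    Parse-++ (terminal pα) pβ = terminal (Parse-++ pα pβ)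
    Parse-++ {w₂ = w} (expand {w₁ = w₁} {w₂ = w₂} x→u pu pα) pβ =
      subst (Parse _) (sym (++-assoc w₁ w₂ w)) (expand x→u pu (Parse-++ pα pβ))

    Parse-++⁻ : ∀ α {β w} → Parse (α ++ β) w →
                ∃[ w₁ ] ∃[ w₂ ] (w ≡ w₁ ++ w₂ × Parse α w₁ × Parse β w₂)
    Parse-++⁻ [] {w = w} pβ = [] , w , refl , [] , pβ
    Parse-++⁻ (inj₁ a ∷ α) (terminal p) with Parse-++⁻ α p
    ... | w₁ , w₂ , refl , pα , pβ = a ∷ w₁ , w₂ , refl , terminal pα , pβ
    Parse-++⁻ (inj₂ x ∷ α) (expand {w₁ = wu} x→u pu p) with Parse-++⁻ α p
    ... | w₁ , w₂ , refl , pα , pβ =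
      wu ++ w₁ , w₂ , sym (++-assoc wu w₁ w₂) , expand x→u pu pα , pβ

    Parse-terminals : ∀ w → Parse (map inj₁ w) w
    Parse-terminals [] = []
    Parse-terminals (a ∷ w) = terminal (Parse-terminals w)

    Parse-⇐ : ∀ {α β w} → G ⊢ α ⇒ β → Parse β w → Parse α w
    Parse-⇐ (step v₁ v₂ x u x→u) p with Parse-++⁻ v₁ p
    ... | w₁ , w' , refl , p₁ , p' with Parse-++⁻ u p'
    ...   | w₂ , w₃ , refl , p₂ , p₃ = Parse-++ p₁ (expand x→u p₂ p₃)

    ⇒*⇒Parse : ∀ {α} w → G ⊢ α ⇒* map inj₁ w → Parse α w
    ⇒*⇒Parse w ε = Parse-terminals w
    ⇒*⇒Parse w (s ◅ d) = Parse-⇐ s (⇒*⇒Parse w d)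

    Run-∷-nullable : ∀ {x} s w → oG G x ≡ true → Run s w → Run (x ∷ s) w
    Run-∷-nullable s [] ox os rewrite ox = os
    Run-∷-nullable {x} s (a ∷ w) ox (s' , s'∈ , run) =
      s' , ∈-++⁺ʳ (_·_ {nA} (δG G x a) s)
             (subst (λ b → s' ∈ (if b then δ̂₁ G s a else [])) (sym ox) s'∈) , run

    -- The bound n on |w| drives the recursion: a step through x → a v shortens w,
    -- a step through x → ε shortens s.
    Parse⇒Run : GreibachNF G → ∀ n s {w} → length w ≤ n →
                Parse (map inj₂ s) w → Run s w
    Parse⇒Run gnf n [] _ [] = refl
    Parse⇒Run gnf n (x ∷ s) |w|≤n (expand {u = u} x→u _ ps) with gnf x u x→u
    Parse⇒Run gnf n (x ∷ s) {w} |w|≤n (expand x→u [] ps) | inj₁ refl =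
      Run-∷-nullable s w (Equivalence.from (oG⇔→ₚε x) x→u) (Parse⇒Run gnf n s |w|≤n ps)
    Parse⇒Run gnf (suc n) (x ∷ s) (s≤s |w|≤n)
              (expand {w₂ = w₂} x→u (terminal {w = w₁} pv) ps) | inj₂ (a , v , refl) =
      v ++ s , ∈-++⁺ˡ (∈-map⁺ (_++ s) (∈-δG⁺ x a x→u)) ,
      Parse⇒Run gnf n (v ++ s) |w|≤n
        (subst (λ γ → Parse γ (w₁ ++ w₂)) (sym (map-++ inj₂ v s)) (Parse-++ pv ps))

    Run⇔⇒* : GreibachNF G → ∀ s w → Run s w ⇔ G ⊢ map inj₂ s ⇒* map inj₁ w
    Run⇔⇒* gnf s w = mk⇔ (Run⇒⇒* s w)
      (λ s⇒*w → Parse⇒Run gnf (length w) s ≤-refl (⇒*⇒Parse w s⇒*w))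

proposition3p7 : ∀ {nA nX : ℕ} (G : Grammar nA nX) → GreibachNF G →
    (S : List (List (Fin nX))) (w : List (Fin nA)) →
    ⟦ G ⟧ S w ⇔ (∃[ s ] (s ∈ S × G ⊢ map inj₂ s ⇒* map inj₁ w))
proposition3p7 G gnf S w = mk⇔
  (λ accepted → let s , s∈S , run = to (⟦⟧⇔Run G S w) accepted
                in s , s∈S , to (Run⇔⇒* G gnf s w) run)
  (λ (s , s∈S , s⇒*w) →
     from (⟦⟧⇔Run G S w) (s , s∈S , from (Run⇔⇒* G gnf s w) s⇒*w))
  where open Equivalence
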